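{- Let $G=(V,E)$ be a connected graph, let $r\colon V\to\mathbb{N}$, and let $\mathcal{T}$ be a tree-decomposition of $G$ of breadth $\rho$ and length $\lambda$. Let $\phi$ be either $3\rho$ or $2\lambda$, and let $T_\phi$ be a minimum $(r+\phi)$-covering subtree of $\mathcal{T}$. If $C_\phi\subseteq V$ is a connected set that contains at least one vertex of each leaf of $T_\phi$, then $C_\phi$ is an $(r+(\phi+\lambda))$-dominating set of $G$.
   Context: All graphs are finite, connected, unweighted, undirected and simple; $d_G$ is the shortest-path distance, $d_G(v,S)=\min_{u\in S}d_G(v,u)$, and $N_G^\rho[v]=\{u: d_G(u,v)\le\rho\}$. A set is connected if it induces a connected subgraph; it is $(r+\psi)$-dominating if $d_G(u,C)\le r(u)+\psi$ for all $u$. A tree-decomposition of $G$ is a tree whose nodes (bags) are subsets of $V$ such that every vertex lies in some bag, every edge has both ends in some bag, and the bags containing any fixed vertex induce a subtree. It has breadth $\rho$ if each bag $B$ satisfies $B\subseteq N_G^\rho[v]$ for some $v$. It has length $\lambda$ if any two vertices in a common bag are at distance at most $\lambda$. A subtree $T'$ is $(r+\phi)$-covering if for each vertex $v$ there is a bag $B'$ of $T'$ with $d_G(v,B')\le r(v)+\phi$. A minimum one has the fewest bags. -}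

module Defs where

open import Data.Nat using (ℕ; zero; suc; _≤_; _+_)
open import Data.Fin using (Fin)
open import Data.Fin.Subset using (Subset; _∈_; ∣_∣)
open import Data.List using (List; []; _∷_; [_])
open import Data.List.Relation.Unary.Unique.Propositional using (Unique)
open import Data.Product using (Σ; ∃; _×_; _,_)
open import Data.Unit using (⊤)
open import Relation.Binary.PropositionalEquality using (_≡_)
open import Relation.Nullary using (¬_)

record Graph (n : ℕ) : Set₁ where
  field
    E     : Fin n → Fin n → Set
    sym   : ∀ {u v} → E u v → E v u
    irrefl : ∀ {u} → ¬ E u u
open Graph public

module _ {n : ℕ} (G : Graph n) where

  data Walk : Fin n → Fin n → ℕ → Set where
    here : ∀ {u} → Walk u u 0
    step : ∀ {u w v k} → E G u w → Walk w v k → Walk u v (suc k)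

  -- d_G(u,v) ≤ k  (d_G is the minimum length of a walk, so this unfolds the definition)
  DistLe : Fin n → Fin n → ℕ → Set
  DistLe u v k = Σ ℕ λ j → j ≤ k × Walk u v j

  data WalkIn (P : Fin n → Set) : Fin n → Fin n → Set where
    here : ∀ {u} → P u → WalkIn P u u
    step : ∀ {u w v} → P u → E G u w → WalkIn P w v → WalkIn P u v

  ConnectedPred : (Fin n → Set) → Set
  ConnectedPred P = ∀ u v → P u → P v → WalkIn P u v

  ConnectedSet : Subset n → Set
  ConnectedSet S = ConnectedPred (λ x → x ∈ S)

  -- the (nonempty) graph is connected
  Connected : Set
  Connected = Fin n × (∀ u v → WalkIn (λ _ → ⊤) u v)

  data PathL : Fin n → Fin n → List (Fin n) → Set where
    single : ∀ {u} → PathL u u [ u ]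
    cons   : ∀ {u w v xs} → E G u w → PathL w v xs → PathL u v (u ∷ xs)

  Path : Fin n → Fin n → List (Fin n) → Set
  Path u v xs = PathL u v xs × Unique xs

  IsTree : Set
  IsTree = Connected × (∀ u v xs ys → Path u v xs → Path u v ys → xs ≡ ys)

record TreeDecomposition {n : ℕ} (G : Graph n) : Set₁ where
  field
    m       : ℕ
    T       : Graph m
    isTree  : IsTree T
    bag     : Fin m → Subset n
    cover-v : ∀ v → Σ (Fin m) λ b → v ∈ bag b
    cover-e : ∀ u v → E G u v → Σ (Fin m) λ b → u ∈ bag b × v ∈ bag b
    subtree : ∀ v → ConnectedPred T (λ b → v ∈ bag b)
open TreeDecomposition public

module _ {n : ℕ} {G : Graph n} (𝒯 : TreeDecomposition G) where

  HasBreadth : ℕ → Set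
  HasBreadth ρ = ∀ b → Σ (Fin n) λ v → ∀ u → u ∈ bag 𝒯 b → DistLe G u v ρ

  HasLength : ℕ → Set
  HasLength λ' = ∀ b u w → u ∈ bag 𝒯 b → w ∈ bag 𝒯 b → DistLe G u w λ'

  IsSubtree : Subset (m 𝒯) → Set
  IsSubtree S = Σ (Fin (m 𝒯)) (λ b → b ∈ S) × ConnectedSet (T 𝒯) S

  IsCovering : (Fin n → ℕ) → ℕ → Subset (m 𝒯) → Set
  IsCovering r φ S = ∀ v → Σ (Fin (m 𝒯)) λ b → b ∈ S ×
                       Σ (Fin n) λ u → u ∈ bag 𝒯 b × DistLe G v u (r v + φ)

  IsMinCoveringSubtree : (Fin n → ℕ) → ℕ → Subset (m 𝒯) → Set
  IsMinCoveringSubtree r φ S =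
    IsSubtree S × IsCovering r φ S ×
    (∀ S' → IsSubtree S' → IsCovering r φ S' → ∣ S ∣ ≤ ∣ S' ∣)

  -- leaf of a subtree S: a node of S with at most one neighbour (in T) inside S
  -- (so the single node of a one-node subtree counts as a leaf)
  IsLeaf : Subset (m 𝒯) → Fin (m 𝒯) → Set
  IsLeaf S b = b ∈ S × (∀ x y → x ∈ S → y ∈ S → E (T 𝒯) b x → E (T 𝒯) b y → x ≡ y)

IsDominating : {n : ℕ} (G : Graph n) → (Fin n → ℕ) → ℕ → Subset n → Set
IsDominating {n} G r ψ C = ∀ u → Σ (Fin n) λ c → c ∈ C × DistLe G u c (r u + ψ)

module Submission where

-- Let C be a connected vertex set meeting the bag of every leaf of a node set S of a
-- tree-decomposition 𝒯.  Then C meets the bag of every node b of S.  Otherwise b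
-- is not a leaf of S, so it has two distinct S-neighbours x and y.  Walking away
-- from b inside S, from x and from y, one reaches leaves Lx and Ly of S; their
-- bags contain vertices of C, and a walk inside C between these vertices passes
-- only through bags meeting C, hence avoids b.  Together this is a walk from x to
-- y avoiding their common neighbour b, i.e. a cycle in the tree: impossible.
--
-- Lemma 11 follows: a vertex u is within r(u)+φ of some vertex u' of a bag of the
-- covering subtree Tφ, that bag contains some c ∈ Cφ, and d(u',c) ≤ λ because
-- u' and c share a bag.  Neither the minimality of Tφ, the breadth bound, the
-- particular value of φ nor the connectivity of G is needed.

open import Defs
open import Data.Nat using (ℕ; zero; suc; _+_; _*_; _≤_; _<_; s≤s; z≤n)
open import Data.Nat.Properties using (+-mono-≤; +-assoc; +-identityʳ; ≤⇒≯; m<n+m)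
open import Data.Fin using (Fin; zero; suc)
open import Data.Fin.Properties using (_≟_; any?; injective⇒≤)
open import Data.Fin.Subset using (Subset; _∈_)
open import Data.Fin.Subset.Properties using (_∈?_)
open import Data.Product using (Σ; _×_; _,_; proj₂)
open import Data.Sum using (_⊎_)
open import Data.Empty using (⊥; ⊥-elim)
open import Data.List using (List; []; _∷_; [_]; _++_; length; lookup)
open import Data.List.Properties using (length-++; ∷-injectiveʳ)
open import Data.List.Relation.Unary.All as All using (All; []; _∷_)
open import Data.List.Relation.Unary.All.Properties using (++⁺; ¬Any⇒All¬)
open import Data.List.Relation.Unary.Any using (here; there)
open import Data.List.Relation.Unary.AllPairs using ([]; _∷_)
open import Data.List.Relation.Unary.Unique.Propositional using (Unique)
import Data.List.Relation.Unary.Unique.Propositional.Properties as Unique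
open import Data.List.Membership.Propositional using () renaming (_∈_ to _∈ᴸ_)
open import Data.List.Membership.Propositional.Properties using (∈-lookup)
open import Function.Definitions using (Injective)
open import Relation.Nullary using (¬_; yes; no)
open import Relation.Nullary.Decidable using (_×-dec_)
open import Relation.Binary.PropositionalEquality
  using (_≡_; _≢_; refl; trans; cong; subst; ≢-sym) renaming (sym to ≡-sym)

lookup-injective : ∀ {A : Set} {xs : List A} → Unique xs → Injective _≡_ _≡_ (lookup xs)
lookup-injective (_ ∷ _) {zero} {zero} _ = refl
lookup-injective (x∉ ∷ _) {zero} {suc j} eq = ⊥-elim (All.lookup x∉ (∈-lookup j) eq)
lookup-injective (x∉ ∷ _) {suc i} {zero} eq = ⊥-elim (All.lookup x∉ (∈-lookup i) (≡-sym eq))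
lookup-injective (_ ∷ u) {suc i} {suc j} eq = cong suc (lookup-injective u eq)

-- Pigeonhole: a duplicate-free list over Fin m has at most m entries.
-- This bounds the length of simple paths and makes the leaf search terminate.
unique-length≤ : ∀ {m} {xs : List (Fin m)} → Unique xs → length xs ≤ m
unique-length≤ u = injective⇒≤ (lookup-injective u)

module Walks {n : ℕ} {G : Graph n} where
  open import Data.List.Membership.DecPropositional (_≟_ {n}) using () renaming (_∈?_ to _∈ᴸ?_)

  _++ʷ_ : ∀ {P u v w} → WalkIn G P u v → WalkIn G P v w → WalkIn G P u w
  here _ ++ʷ q = q
  step p e w ++ʷ q = step p e (w ++ʷ q)

  infixr 5 _++ʷ_

  mapʷ : ∀ {P Q : Fin n → Set} {u v} → (∀ {t} → P t → Q t) → WalkIn G P u v → WalkIn G Q u v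
  mapʷ f (here p) = here (f p)
  mapʷ f (step p e w) = step (f p) e (mapʷ f w)

  endʷ : ∀ {P u v} → WalkIn G P u v → P v
  endʷ (here p) = p
  endʷ (step _ _ w) = endʷ w

  reverseʷ : ∀ {P u v} → WalkIn G P u v → WalkIn G P v u
  reverseʷ (here p) = here p
  reverseʷ (step p e w) = reverseʷ w ++ʷ step (endʷ (reverseʷ w)) (sym G e) (here p)

  dist-trans : ∀ {u v w a c} → DistLe G u v a → DistLe G v w c → DistLe G u w (a + c)
  dist-trans (j , j≤a , p) (k , k≤c , q) = j + k , +-mono-≤ j≤a k≤c , concat p q
    where
    concat : ∀ {u v w j k} → Walk G u v j → Walk G v w k → Walk G u w (j + k)
    concat here q = q
    concat (step e p) q = step e (concat p q)

  edge⇒≢ : ∀ {u v} → E G u v → u ≢ v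
  edge⇒≢ e refl = irrefl G e

  edgePath : ∀ {u v} → E G u v → Path G u v (u ∷ v ∷ [])
  edgePath e = cons e single , (edge⇒≢ e ∷ []) ∷ [] ∷ []

  pathStart : ∀ {u v z zs} → PathL G u v (z ∷ zs) → z ≡ u
  pathStart single = refl
  pathStart (cons _ _) = refl

  pathEnd∈ : ∀ {u v xs} → PathL G u v xs → v ∈ᴸ xs
  pathEnd∈ single = here refl
  pathEnd∈ (cons _ p) = there (pathEnd∈ p)

  pathToWalk : ∀ {P u v xs} → PathL G u v xs → All P xs → WalkIn G P u v
  pathToWalk single (p ∷ []) = here p
  pathToWalk (cons e q) (p ∷ ps) = step p e (pathToWalk q ps)

  pathSnoc : ∀ {u v z xs} → PathL G u v xs → E G v z → PathL G u z (xs ++ [ z ])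
  pathSnoc single e = cons e single
  pathSnoc (cons e' p) e = cons e' (pathSnoc p e)

  SimplePath : (Fin n → Set) → Fin n → Fin n → Set
  SimplePath P u v = Σ (List (Fin n)) λ xs → PathL G u v xs × Unique xs × All P xs

  pathFrom : ∀ {P u v y xs} → PathL G u v xs → Unique xs → All P xs → y ∈ᴸ xs → SimplePath P y v
  pathFrom single u a (here refl) = _ , single , u , a
  pathFrom (cons e p) u a (here refl) = _ , cons e p , u , a
  pathFrom (cons _ p) (_ ∷ u) (_ ∷ a) (there y∈) = pathFrom p u a y∈

  walkToPath : ∀ {P u v} → WalkIn G P u v → SimplePath P u v
  walkToPath (here p) = _ , single , [] ∷ [] , p ∷ []
  walkToPath {u = u} (step p e w) with walkToPath w
  ... | ys , q , uq , aq with u ∈ᴸ? ys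
  ... | yes u∈ys = pathFrom q uq aq u∈ys
  ... | no u∉ys = u ∷ ys , cons e q , ¬Any⇒All¬ ys u∉ys ∷ uq , p ∷ aq

  -- The part of a simple path from its start u to one of its vertices y ≠ v
  -- avoids the end v (v occurs only once, at the end).
  pathPrefix : ∀ {u v y xs} → PathL G u v xs → Unique xs → y ∈ᴸ xs → y ≢ v → WalkIn G (v ≢_) u y
  pathPrefix single _ (here refl) y≢v = ⊥-elim (y≢v refl)
  pathPrefix (cons _ _) _ (here refl) y≢v = here (≢-sym y≢v)
  pathPrefix (cons e p) (u∉ ∷ up) (there y∈) y≢v =
    step (≢-sym (All.lookup u∉ (pathEnd∈ p))) e (pathPrefix p up y∈ y≢v)

open Walks

module Tree {m : ℕ} (T : Graph m)
  (pathsUnique : ∀ u v xs ys → Path T u v xs → Path T u v ys → xs ≡ ys) where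
  open import Data.List.Membership.DecPropositional (_≟_ {m}) using () renaming (_∈?_ to _∈ᴸ?_)

  -- No cycles: distinct neighbours x, y of b are not joined by a walk avoiding b,
  -- for then b, x, …, y and b, y would be two different paths from b to y.
  noCycle : ∀ {b x y} → E T b x → E T b y → x ≢ y → ¬ WalkIn T (b ≢_) x y
  noCycle {b} {x} {y} bx by x≢y w with walkToPath w
  ... | xs , x⇝y , xs-unique , b∉xs = x≢y (≡-sym (pathStart (subst (PathL T x y) xs≡[y] x⇝y)))
    where
    xs≡[y] : xs ≡ y ∷ []
    xs≡[y] = ∷-injectiveʳ (pathsUnique b y _ _ (cons bx x⇝y , b∉xs ∷ xs-unique) (edgePath {G = T} by))

  -- Two neighbours of the end v of a simple path that both lie on the path coincide:
  -- otherwise the path joins them while avoiding v.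
  neighboursOnPath : ∀ {u v y₁ y₂ xs} → PathL T u v xs → Unique xs → y₁ ∈ᴸ xs → y₂ ∈ᴸ xs →
                     E T v y₁ → E T v y₂ → y₁ ≡ y₂
  neighboursOnPath {y₁ = y₁} {y₂} p p-unique y₁∈ y₂∈ vy₁ vy₂ with y₁ ≟ y₂
  ... | yes y₁≡y₂ = y₁≡y₂
  ... | no y₁≢y₂ = ⊥-elim (noCycle vy₁ vy₂ y₁≢y₂
          (reverseʷ (pathPrefix p p-unique y₁∈ (≢-sym (edge⇒≢ {G = T} vy₁)))
            ++ʷ pathPrefix p p-unique y₂∈ (≢-sym (edge⇒≢ {G = T} vy₂))))

  IsLeafOf : Subset m → Fin m → Set
  IsLeafOf S L = L ∈ S × (∀ x y → x ∈ S → y ∈ S → E T L x → E T L y → x ≡ y)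

  -- A simple path b, x, …, e
  -- inside S that cannot be extended ends in a leaf: every S-neighbour of e lies on
  -- the path, and two such neighbours coincide.  The path length is bounded by m.
  -- Adjacency is not decidable, so the leaf is only obtained under double negation.
  leafBeyond : ∀ {b x} (S : Subset m) → E T b x → x ∈ S →
               ¬ ¬ (Σ (Fin m) λ L → IsLeafOf S L × WalkIn T (λ t → t ∈ S × b ≢ t) x L)
  leafBeyond {b} {x} S bx x∈S noLeaf =
    extend m (x ∷ []) single (proj₂ (edgePath {G = T} bx)) (x∈S ∷ []) (m<n+m m (s≤s z≤n))
    where
    -- Q is the path x, …, e; the fuel k exceeds the number of possible extensions.
    extend : ∀ (k : ℕ) {e} Q → PathL T x e Q → Unique (b ∷ Q) → All (_∈ S) Q →
             m < length (b ∷ Q) + k → ⊥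
    extend zero Q _ Q-unique _ bound =
      ≤⇒≯ (unique-length≤ Q-unique) (subst (m <_) (+-identityʳ _) bound)
    extend (suc k) {e} Q x⇝e Q-unique@(b∉Q ∷ _) Q⊆S bound =
      noLeaf (e , (e∈S , atMostOne) , pathToWalk x⇝e (All.zip (Q⊆S , b∉Q)))
      where
      e∈S : e ∈ S
      e∈S = All.lookup Q⊆S (pathEnd∈ x⇝e)

      onPath : ∀ z → z ∈ S → E T e z → z ∈ᴸ (b ∷ Q)
      onPath z z∈S ez with z ∈ᴸ? (b ∷ Q)
      ... | yes z∈ = z∈
      ... | no z∉ = ⊥-elim (extend k (Q ++ [ z ]) (pathSnoc x⇝e ez)
                      (Unique.++⁺ Q-unique ([] ∷ []) λ { (z∈ , here refl) → z∉ z∈ })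
                      (++⁺ Q⊆S (z∈S ∷ [])) (subst (m <_) longer bound))
        where
        longer : length (b ∷ Q) + suc k ≡ length (b ∷ Q ++ [ z ]) + k
        longer = ≡-sym (trans (cong (_+ k) (length-++ (b ∷ Q))) (+-assoc (length (b ∷ Q)) 1 k))

      atMostOne : ∀ y₁ y₂ → y₁ ∈ S → y₂ ∈ S → E T e y₁ → E T e y₂ → y₁ ≡ y₂
      atMostOne y₁ y₂ y₁∈S y₂∈S ey₁ ey₂ =
        neighboursOnPath (cons bx x⇝e) Q-unique (onPath y₁ y₁∈S ey₁) (onPath y₂ y₂∈S ey₂) ey₁ ey₂

-- The bags meeting the vertices of a walk inside P are connected in the
-- decomposition tree: consecutive vertices share a bag, and the bags containing a
-- fixed vertex form a subtree.
bagsAlongWalk : ∀ {n} {G : Graph n} (𝒯 : TreeDecomposition G) {P u v p q} →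
                WalkIn G P u v → u ∈ bag 𝒯 p → v ∈ bag 𝒯 q →
                WalkIn (T 𝒯) (λ t → Σ (Fin n) λ w → P w × w ∈ bag 𝒯 t) p q
bagsAlongWalk 𝒯 (here Pu) u∈p u∈q = mapʷ (λ u∈t → _ , Pu , u∈t) (subtree 𝒯 _ _ _ u∈p u∈q)
bagsAlongWalk 𝒯 (step Pu uw w⇝v) u∈p v∈q with cover-e 𝒯 _ _ uw
... | s , u∈s , w∈s =
  mapʷ (λ u∈t → _ , Pu , u∈t) (subtree 𝒯 _ _ _ u∈p u∈s) ++ʷ bagsAlongWalk 𝒯 w⇝v w∈s v∈q

Meets : ∀ {n} {G : Graph n} (𝒯 : TreeDecomposition G) → Subset n → Fin (m 𝒯) → Set
Meets {n} 𝒯 C b = Σ (Fin n) λ c → c ∈ C × c ∈ bag 𝒯 b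

module _ {n} {G : Graph n} (𝒯 : TreeDecomposition G) (S : Subset (m 𝒯))
         (C : Subset n) (C-connected : ConnectedSet G C)
         (leavesMeet : ∀ L → IsLeaf 𝒯 S L → Meets 𝒯 C L) where
  open Tree (T 𝒯) (proj₂ (isTree 𝒯))

  -- A node of S whose bag misses C is a leaf of S: from two distinct S-neighbours
  -- x, y of b, leaves beyond x and y and a walk in C between their bags (which
  -- avoids b) would give a walk from x to y avoiding b.
  missedBag-isLeaf : ∀ b → b ∈ S → ¬ Meets 𝒯 C b → IsLeaf 𝒯 S b
  missedBag-isLeaf b b∈S misses = b∈S , atMostOne
    where
    LeafBeyond : Fin (m 𝒯) → Set
    LeafBeyond x = Σ (Fin (m 𝒯)) λ L → IsLeafOf S L × WalkIn (T 𝒯) (λ t → t ∈ S × b ≢ t) x L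

    avoidsB : ∀ {t} → Meets 𝒯 C t → b ≢ t
    avoidsB C-meets-t refl = misses C-meets-t

    joinAvoidingB : ∀ {x y} → LeafBeyond x → LeafBeyond y → WalkIn (T 𝒯) (b ≢_) x y
    joinAvoidingB (Lx , Lx-leaf , x⇝Lx) (Ly , Ly-leaf , y⇝Ly)
      with leavesMeet Lx Lx-leaf | leavesMeet Ly Ly-leaf
    ... | cx , cx∈C , cx∈Lx | cy , cy∈C , cy∈Ly =
      mapʷ proj₂ x⇝Lx
        ++ʷ mapʷ avoidsB (bagsAlongWalk 𝒯 (C-connected cx cy cx∈C cy∈C) cx∈Lx cy∈Ly)
        ++ʷ reverseʷ (mapʷ proj₂ y⇝Ly)

    atMostOne : ∀ x y → x ∈ S → y ∈ S → E (T 𝒯) b x → E (T 𝒯) b y → x ≡ y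
    atMostOne x y x∈S y∈S bx by with x ≟ y
    ... | yes x≡y = x≡y
    ... | no x≢y = ⊥-elim (leafBeyond S bx x∈S λ beyondX → leafBeyond S by y∈S λ beyondY →
                     noCycle bx by x≢y (joinAvoidingB beyondX beyondY))

  -- Hence C meets every bag of S (meeting a bag is decidable).
  meetsEveryBag : ∀ b → b ∈ S → Meets 𝒯 C b
  meetsEveryBag b b∈S with any? (λ c → (c ∈? C) ×-dec (c ∈? bag 𝒯 b))
  ... | yes meets = meets
  ... | no misses = ⊥-elim (misses (leavesMeet b (missedBag-isLeaf b b∈S misses)))

lemma11 : {n : ℕ} (G : Graph n) → Connected G → (r : Fin n → ℕ) →
          (𝒯 : TreeDecomposition G) (ρ λ' : ℕ) → HasBreadth 𝒯 ρ → HasLength 𝒯 λ' →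
          (φ : ℕ) → (φ ≡ 3 * ρ ⊎ φ ≡ 2 * λ') →
          (Tφ : Subset (m 𝒯)) → IsMinCoveringSubtree 𝒯 r φ Tφ →
          (Cφ : Subset n) → ConnectedSet G Cφ →
          (∀ b → IsLeaf 𝒯 Tφ b → Σ (Fin n) λ v → v ∈ Cφ × v ∈ bag 𝒯 b) →
          IsDominating G r (φ + λ') Cφ
lemma11 G _ r 𝒯 _ λ' _ bagLength φ _ Tφ (_ , covering , _) Cφ Cφ-connected leavesMeet u
  with covering u
... | b , b∈Tφ , u' , u'∈b , u⇝u'
  with meetsEveryBag 𝒯 Tφ Cφ Cφ-connected leavesMeet b b∈Tφ
... | c , c∈Cφ , c∈b =
  c , c∈Cφ , subst (DistLe G u c) (+-assoc (r u) φ λ') (dist-trans u⇝u' (bagLength b u' c u'∈b c∈b))
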